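{- Let $p\ge2$ be an integer and let $0<\alpha<\beta$ be irrational real numbers such that the homogeneous Beatty sequences $(x_i)_{i\in\mathbb{N}_0}=(\lfloor \alpha i\rfloor)_{i\in\mathbb{N}_0}$ and $(y_i)_{i\in\mathbb{N}}=(\lfloor\beta i\rfloor)_{i\in\mathbb{N}}$ are $p$-complementary on $\mathbb{N}_0$. Then for every integer $0\le l<p$, the sequences $(x_{pi+l})_{i\in\mathbb{N}_0}$ and $(y_{pi-l})_{i\in\mathbb{N}}$ are complementary on $\mathbb{N}_0$, i.e. every non-negative integer occurs exactly once in total among their terms.
   Context: $\mathbb{N}=\{1,2,\dots\}$, $\mathbb{N}_0=\{0,1,2,\dots\}$. For $p\in\mathbb{N}$ and $S\subseteq\mathbb{Z}$, two sequences $(x_i)_{i\in Q}$, $(y_i)_{i\in R}$ of non-negative integers are $p$-complementary on $S$ if for each $n\in S$, $\#\{i\in Q: x_i=n\}+\#\{i\in R:y_i=n\}=p$; complementary means $1$-complementary. -}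

module Defs where

open import Data.Nat using (ℕ; zero; suc; _*_; _+_; _∸_; _≥_; _<_)
open import Data.Integer using (+_)
open import Data.Rational using (ℚ; _/_; 0ℚ) renaming (_<_ to _<ℚ_; _≤_ to _≤ℚ_)
open import Data.Bool using (Bool; true; false)
open import Data.Fin using (Fin)
open import Data.Product using (Σ; ∃; _×_)
open import Data.Sum using (_⊎_)
open import Function.Bundles using (_↔_)
open import Relation.Binary.PropositionalEquality using (_≡_)

-- An irrational real number, given (following Dedekind) as an irrational cut
-- of ℚ: a partition of ℚ into a non-empty lower class and a non-empty upper
-- class, where the lower class is downward closed, has no maximum, and the
-- upper class has no minimum (no rational number produces the cut).
-- `lower q ≡ true` means q < α.
record Irrational : Set where
  field
    lower      : ℚ → Bool
    inhabited  : ∃ λ q → lower q ≡ true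
    bounded    : ∃ λ q → lower q ≡ false
    downClosed : ∀ q r → q ≤ℚ r → lower r ≡ true → lower q ≡ true
    noMax      : ∀ q → lower q ≡ true → ∃ λ r → q <ℚ r × lower r ≡ true
    noMin      : ∀ q → lower q ≡ false → ∃ λ r → r <ℚ q × lower r ≡ false
open Irrational public

Positive : Irrational → Set
Positive α = lower α 0ℚ ≡ true

_<ᵢ_ : Irrational → Irrational → Set
α <ᵢ β = ∃ λ q → lower α q ≡ false × lower β q ≡ true

-- FloorIs α i n  :⇔  ⌊ α i ⌋ = n   (for i ≥ 1 and α irrational this is
-- n/i < α < (n+1)/i; for i = 0, ⌊α·0⌋ = 0).
FloorIs : Irrational → ℕ → ℕ → Set
FloorIs α zero    n = n ≡ 0
FloorIs α (suc k) n = lower α (+ n / suc k) ≡ true × lower α (+ suc n / suc k) ≡ false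

-- A sequence of non-negative integers given as the relation
-- "the term at index i equals n" (TermIs i n).
PComplementary : ℕ → (ℕ → ℕ → Set) → (ℕ → ℕ → Set) → Set
PComplementary p X Y = ∀ (n : ℕ) → ((Σ ℕ λ i → X i n) ⊎ (Σ ℕ λ j → Y j n)) ↔ Fin p

module Submission where

-- For a positive irrational γ let Cγ(n) be the number of
-- indices k with ⌊γ k⌋ < n.  Since k ↦ ⌊γ k⌋ is non-decreasing, the indices
-- with ⌊γ k⌋ = n form the interval [Cγ(n), Cγ(n+1)).  Write A for this
-- counting function of (⌊α i⌋)_{i ≥ 0} and B for that of (⌊β j⌋)_{j ≥ 1}
-- (indexed from 0).  p-complementarity says the two intervals at level n have
-- total length p, so A(n) + B(n) = p n by telescoping.
-- Now fix n and write p = l + e + 1.  The values x_{pi+l} equal to n are the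
-- indices p i + l in the window [A(n), A(n+1)); the values y_{pj-l}, i.e.
-- β-terms with shifted index p j + e, equal to n are the p j + e in
-- [B(n), B(n+1)).  Both windows have length ≤ p and their endpoints sum to
-- p n and p (n + 1); pure residue arithmetic then shows that exactly one such
-- index exists in total, which is the required 1-complementarity.
-- The file develops: counting of finite sets via bijections with Fin;
-- counting functions of monotone "staircase" relations; the staircase of a
-- positive irrational; the telescoping identity; the residue arithmetic in
-- windows; and finally the theorem.

open import Defs
open import Axiom.UniquenessOfIdentityProofs using (module Decidable⇒UIP)
open import Data.Bool using (Bool; true; false)
import Data.Bool as Bool
import Data.Bool.Properties as BoolP
open import Data.Empty using (⊥; ⊥-elim)
open import Data.Fin using (Fin; toℕ; fromℕ<)
import Data.Fin.Properties as FinP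
open import Data.Fin.Permutation using (↔⇒≡)
open import Data.Integer as ℤ using (+_; -[1+_])
import Data.Integer.Properties as ℤP
open import Data.Nat using (ℕ; zero; suc; _+_; _*_; _∸_; _≤_; _<_; _≥_; z≤n; s≤s; s<s⁻¹; _<?_)
import Data.Nat.Properties as ℕP
open import Data.Nat.Tactic.RingSolver using (solve-∀)
open import Data.Product using (Σ; _×_; _,_; proj₁; proj₂)
open import Data.Rational using (mkℚ; 0ℚ; *<*) renaming (_/_ to _/ℚ_; _≤_ to _≤ℚ_; _<_ to _<ℚ_)
import Data.Rational.Properties as ℚP
open import Data.Rational.Unnormalised using (mkℚᵘ; *≤*)
import Data.Rational.Unnormalised.Properties as ℚᵘP
open import Data.Sum using (_⊎_; inj₁; inj₂; map)
open import Data.Sum.Function.Propositional using (_⊎-↔_)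
open import Function.Bundles using (_↔_; mk↔ₛ′)
open import Function.Properties.Inverse using (↔-sym; ↔-trans)
open import Relation.Nullary using (¬_; Dec; yes; no)
open import Relation.Binary.PropositionalEquality

-- Counting subsets of ℕ by bijections with Fin

IsPropFamily : (ℕ → Set) → Set
IsPropFamily P = ∀ x (u v : P x) → u ≡ v

Σ-≡ : {P : ℕ → Set} → IsPropFamily P → ∀ {x y} {u : P x} {v : P y} →
      x ≡ y → _≡_ {A = Σ ℕ P} (x , u) (y , v)
Σ-≡ isProp {x} {u = u} {v} refl = cong (x ,_) (isProp x u v)

Σ-⇔↔ : {P Q : ℕ → Set} → IsPropFamily P → IsPropFamily Q →
       (∀ x → P x → Q x) → (∀ x → Q x → P x) → Σ ℕ P ↔ Σ ℕ Q
Σ-⇔↔ isPropP isPropQ P⇒Q Q⇒P = mk↔ₛ′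
  (λ { (x , u) → x , P⇒Q x u }) (λ { (x , v) → x , Q⇒P x v })
  (λ _ → Σ-≡ isPropQ refl) (λ _ → Σ-≡ isPropP refl)

Interval : ℕ → ℕ → ℕ → Set
Interval a b m = a ≤ m × m < b

Interval-isProp : ∀ a b → IsPropFamily (Interval a b)
Interval-isProp a b _ (u₁ , u₂) (v₁ , v₂) = cong₂ _,_ (ℕP.≤-irrelevant u₁ v₁) (ℕP.≤-irrelevant u₂ v₂)

Interval↔Fin : ∀ {a b} → a ≤ b → Σ ℕ (Interval a b) ↔ Fin (b ∸ a)
Interval↔Fin {a} {b} a≤b = mk↔ₛ′ to from to∘from from∘to
  where
  to : Σ ℕ (Interval a b) → Fin (b ∸ a)
  to (m , a≤m , m<b) = fromℕ< (ℕP.∸-monoˡ-< m<b a≤m)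
  from : Fin (b ∸ a) → Σ ℕ (Interval a b)
  from i = a + toℕ i , ℕP.m≤m+n a (toℕ i) ,
           subst (a + toℕ i <_) (ℕP.m+[n∸m]≡n a≤b) (ℕP.+-monoʳ-< a (FinP.toℕ<n i))
  to∘from : ∀ i → to (from i) ≡ i
  to∘from i = trans (FinP.fromℕ<-cong _ _ (ℕP.m+n∸m≡n a (toℕ i)) _ (FinP.toℕ<n i))
                    (FinP.fromℕ<-toℕ i _)
  from∘to : ∀ x → from (to x) ≡ x
  from∘to (m , a≤m , _) =
    Σ-≡ (Interval-isProp a b) (trans (cong (_+_ a) (FinP.toℕ-fromℕ< _)) (ℕP.m+[n∸m]≡n a≤m))

exactlyOne↔Fin1 : {P Q : ℕ → Set} → IsPropFamily P → IsPropFamily Q →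
  (∀ {i i′} → P i → P i′ → i ≡ i′) → (∀ {j j′} → Q j → Q j′ → j ≡ j′) →
  (∀ {i j} → P i → Q j → ⊥) → Σ ℕ P ⊎ Σ ℕ Q → (Σ ℕ P ⊎ Σ ℕ Q) ↔ Fin 1
exactlyOne↔Fin1 {P} {Q} isPropP isPropQ uniqueP uniqueQ disjoint witness =
  mk↔ₛ′ (λ _ → Fin.zero) (λ _ → witness) onlyZero (allEqual witness)
  where
  onlyZero : ∀ (i : Fin 1) → Fin.zero ≡ i
  onlyZero Fin.zero = refl
  allEqual : ∀ x y → x ≡ y
  allEqual (inj₁ (_ , u)) (inj₁ (_ , v)) = cong inj₁ (Σ-≡ isPropP (uniqueP u v))
  allEqual (inj₂ (_ , u)) (inj₂ (_ , v)) = cong inj₂ (Σ-≡ isPropQ (uniqueQ u v))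
  allEqual (inj₁ (_ , u)) (inj₂ (_ , v)) = ⊥-elim (disjoint u v)
  allEqual (inj₂ (_ , u)) (inj₁ (_ , v)) = ⊥-elim (disjoint v u)

-- Counting functions of staircases

record Staircase : Set₁ where
  field
    Below     : ℕ → ℕ → Set
    below?    : ∀ k n → Dec (Below k n)
    antitone  : ∀ {k k′ n} → k′ ≤ k → Below k n → Below k′ n
    monotone  : ∀ {k n n′} → n ≤ n′ → Below k n → Below k n′
    emptyAt0  : ∀ k → ¬ Below k 0
    exceeds   : ∀ n → Σ ℕ λ k → ¬ Below k n

module Counting (S : Staircase) where
  open Staircase S

  Counts : ℕ → ℕ → Set
  Counts n c = (∀ k → Below k n → k < c) × (∀ k → k < c → Below k n)

  search : ∀ n K → ¬ Below K n → Σ ℕ (Counts n)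
  search n zero ¬below = 0 , (λ k below → ⊥-elim (¬below (antitone z≤n below))) , (λ _ ())
  search n (suc K) ¬below with below? K n
  ... | no ¬belowK = search n K ¬belowK
  ... | yes belowK = suc K , below-bounded , (λ { k (s≤s k≤K) → antitone k≤K belowK })
    where
    below-bounded : ∀ k → Below k n → k < suc K
    below-bounded k below with ℕP.≤-<-connex (suc K) k
    ... | inj₁ K<k  = ⊥-elim (¬below (antitone K<k below))
    ... | inj₂ k≤K = k≤K

  -- The count is kept opaque: only its characterisation below is ever used.
  opaque
    count : ℕ → ℕ
    count n = proj₁ (search n (proj₁ (exceeds n)) (proj₂ (exceeds n)))

    below⇒< : ∀ {k n} → Below k n → k < count n
    below⇒< {k} {n} = proj₁ (proj₂ (search n (proj₁ (exceeds n)) (proj₂ (exceeds n)))) k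

    <⇒below : ∀ {k n} → k < count n → Below k n
    <⇒below {k} {n} = proj₂ (proj₂ (search n (proj₁ (exceeds n)) (proj₂ (exceeds n)))) k

  count-zero : count 0 ≡ 0
  count-zero = ℕP.n≤0⇒n≡0 (ℕP.≮⇒≥ λ 0<c → emptyAt0 0 (<⇒below 0<c))

  count-mono : ∀ n → count n ≤ count (suc n)
  count-mono n = ℕP.≮⇒≥ λ lt → ℕP.<-irrefl refl (below⇒< (monotone (ℕP.n≤1+n n) (<⇒below lt)))

  step⇒interval : ∀ {k n} → ¬ Below k n × Below k (suc n) → Interval (count n) (count (suc n)) k
  step⇒interval (¬below , below) = ℕP.≮⇒≥ (λ lt → ¬below (<⇒below lt)) , below⇒< below

  interval⇒step : ∀ {k n} → Interval (count n) (count (suc n)) k → ¬ Below k n × Below k (suc n)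
  interval⇒step (c≤k , k<c′) = (λ below → ℕP.≤⇒≯ c≤k (below⇒< below)) , <⇒below k<c′

  step↔Fin : ∀ {n} {F : ℕ → Set} → IsPropFamily F →
    (∀ k → F k → ¬ Below k n × Below k (suc n)) → (∀ k → ¬ Below k n × Below k (suc n) → F k) →
    Σ ℕ F ↔ Fin (count (suc n) ∸ count n)
  step↔Fin {n} isPropF F⇒step step⇒F = ↔-trans
    (Σ-⇔↔ isPropF (Interval-isProp _ _)
      (λ k u → step⇒interval (F⇒step k u)) (λ k u → step⇒F k (interval⇒step u)))
    (Interval↔Fin (count-mono n))

-- Cuts and rationals

true-and-false : ∀ {b : Bool} → b ≡ true → b ≡ false → ⊥
true-and-false refl ()

-- Equalities of Booleans are unique, so FloorIs is proposition-valued.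
Bool-UIP : {x y : Bool} (u v : x ≡ y) → u ≡ v
Bool-UIP = Decidable⇒UIP.≡-irrelevant Bool._≟_

upperClosed : ∀ γ {q r} → q ≤ℚ r → lower γ q ≡ false → lower γ r ≡ false
upperClosed γ {q} {r} q≤r q-upper with lower γ r in eq
... | false = refl
... | true  = ⊥-elim (true-and-false (downClosed γ q r q≤r eq) q-upper)

frac≤ : ∀ a b c d → a * suc d ≤ b * suc c → (+ a /ℚ suc c) ≤ℚ (+ b /ℚ suc d)
frac≤ a b c d le = ℚP.toℚᵘ-cancel-≤
  (ℚᵘP.≤-respˡ-≃ (ℚᵘP.≃-sym (ℚP.toℚᵘ-fromℚᵘ (mkℚᵘ (+ a) c)))
  (ℚᵘP.≤-respʳ-≃ (ℚᵘP.≃-sym (ℚP.toℚᵘ-fromℚᵘ (mkℚᵘ (+ b) d)))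
  (*≤* (subst₂ ℤ._≤_ (ℤP.pos-* a (suc d)) (ℤP.pos-* b (suc c)) (ℤ.+≤+ le)))))

positive-form : ∀ r → 0ℚ <ℚ r → Σ ℕ λ b → Σ ℕ λ d → (+ suc b /ℚ suc d) ≡ r
positive-form (mkℚ (+ zero) _ _) (*<* (ℤ.+<+ ()))
positive-form (mkℚ -[1+ _ ] _ _) (*<* ())
positive-form r@(mkℚ (+ suc b) d _) _ = b , d , ℚP.↥p/↧p≡p r

positive-mono : ∀ {α β} → Positive α → α <ᵢ β → Positive β
positive-mono {α} {β} α>0 (q , q∉α , q∈β) with ℚP.≤-total 0ℚ q
... | inj₁ 0≤q = downClosed β 0ℚ q 0≤q q∈β
... | inj₂ q≤0 = ⊥-elim (true-and-false (downClosed α q 0ℚ q≤0 α>0) q∉α)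

-- The staircase of a positive irrational

-- FloorBelow γ k n  :⇔  ⌊γ k⌋ < n; for k ≥ 1 this means γ < n/k.
FloorBelow : Irrational → ℕ → ℕ → Set
FloorBelow γ zero    n = 0 < n
FloorBelow γ (suc k) n = lower γ (+ n /ℚ suc k) ≡ false

floor⇒step : ∀ γ k n → FloorIs γ k n → ¬ FloorBelow γ k n × FloorBelow γ k (suc n)
floor⇒step γ zero    n refl                 = (λ ()) , s≤s z≤n
floor⇒step γ (suc k) n (n-lower , sn-upper) = true-and-false n-lower , sn-upper

step⇒floor : ∀ γ k n → ¬ FloorBelow γ k n × FloorBelow γ k (suc n) → FloorIs γ k n
step⇒floor γ zero    zero    _                = refl
step⇒floor γ zero    (suc n) (¬0<sn , _)      = ⊥-elim (¬0<sn (s≤s z≤n))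
step⇒floor γ (suc k) n       (¬below , below) = BoolP.¬-not ¬below , below

FloorIs-isProp : ∀ γ n → IsPropFamily (λ k → FloorIs γ k n)
FloorIs-isProp γ n zero    u v = ℕP.≡-irrelevant u v
FloorIs-isProp γ n (suc k) (u₁ , u₂) (v₁ , v₂) = cong₂ _,_ (Bool-UIP u₁ v₁) (Bool-UIP u₂ v₂)

module FloorStaircase (γ : Irrational) (γ>0 : Positive γ) where

  floorBelow? : ∀ k n → Dec (FloorBelow γ k n)
  floorBelow? zero    n = 0 <? n
  floorBelow? (suc k) n = lower γ (+ n /ℚ suc k) Bool.≟ false

  emptyAt0 : ∀ k → ¬ FloorBelow γ k 0
  emptyAt0 zero    ()
  emptyAt0 (suc k) below = true-and-false (downClosed γ _ 0ℚ (frac≤ 0 0 k 0 z≤n) γ>0) below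

  -- k′ ≤ k gives n/(k+1) ≤ n/(k′+1), and the upper class is upward closed.
  antitone : ∀ {k k′ n} → k′ ≤ k → FloorBelow γ k n → FloorBelow γ k′ n
  antitone {zero}  {zero}            _          below = below
  antitone {suc k} {zero}  {zero}    _          below = ⊥-elim (emptyAt0 (suc k) below)
  antitone {suc k} {zero}  {suc n}   _          _     = s≤s z≤n
  antitone {suc k} {suc k′} {n}      (s≤s k′≤k) below =
    upperClosed γ (frac≤ n n k k′ (ℕP.*-monoʳ-≤ n (s≤s k′≤k))) below

  monotone : ∀ {k n n′} → n ≤ n′ → FloorBelow γ k n → FloorBelow γ k n′
  monotone {zero}           n≤n′ below = ℕP.<-≤-trans below n≤n′
  monotone {suc k} {n} {n′} n≤n′ below =
    upperClosed γ (frac≤ n n′ k k (ℕP.*-monoˡ-≤ (suc k) n≤n′)) below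

  -- Archimedean bound: pick a rational (b+1)/(d+1) in the lower class; then
  -- (n+1)/((n+1)(d+1)) lies in it too, so ⌊γ (n+1)(d+1)⌋ ≥ n + 1.
  exceeds : ∀ n → Σ ℕ λ k → ¬ FloorBelow γ (suc k) n
  exceeds zero = 0 , emptyAt0 1
  exceeds (suc n) with noMax γ 0ℚ γ>0
  ... | r , 0<r , r-lower with positive-form r 0<r
  ... | b , d , refl = d + n * suc d , true-and-false
    (downClosed γ _ _ (frac≤ (suc n) (suc b) (d + n * suc d) d (ℕP.m≤n*m (suc n * suc d) (suc b))) r-lower)

  staircase : Staircase
  staircase = record
    { Below = FloorBelow γ ; below? = floorBelow? ; antitone = antitone ; monotone = monotone
    ; emptyAt0 = emptyAt0 ; exceeds = λ n → suc (proj₁ (exceeds n)) , proj₂ (exceeds n) }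

  shiftedStaircase : Staircase
  shiftedStaircase = record
    { Below = λ k → FloorBelow γ (suc k) ; below? = λ k → floorBelow? (suc k)
    ; antitone = λ {k} {k′} {n} k′≤k → antitone {suc k} {suc k′} {n} (s≤s k′≤k)
    ; monotone = λ {k} → monotone {suc k} ; emptyAt0 = λ k → emptyAt0 (suc k) ; exceeds = exceeds }

-- Telescoping

telescope : ∀ p (A B : ℕ → ℕ) → A 0 + B 0 ≡ 0 → (∀ n → A n ≤ A (suc n)) → (∀ n → B n ≤ B (suc n)) →
  (∀ n → (A (suc n) ∸ A n) + (B (suc n) ∸ B n) ≡ p) → ∀ n → A n + B n ≡ p * n
telescope p A B start monoA monoB growth zero = trans start (sym (ℕP.*-zeroʳ p))
telescope p A B start monoA monoB growth (suc n) = begin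
  A (suc n) + B (suc n)
    ≡⟨ sym (cong₂ _+_ (ℕP.m+[n∸m]≡n (monoA n)) (ℕP.m+[n∸m]≡n (monoB n))) ⟩
  (A n + (A (suc n) ∸ A n)) + (B n + (B (suc n) ∸ B n))
    ≡⟨ interchange (A n) (B n) (A (suc n) ∸ A n) (B (suc n) ∸ B n) ⟩
  (A n + B n) + ((A (suc n) ∸ A n) + (B (suc n) ∸ B n))
    ≡⟨ cong₂ _+_ (telescope p A B start monoA monoB growth n) (growth n) ⟩
  p * n + p
    ≡⟨ trans (ℕP.+-comm (p * n) p) (sym (ℕP.*-suc p n)) ⟩
  p * suc n ∎
  where
  open ≡-Reasoning
  interchange : ∀ a b c d → (a + c) + (b + d) ≡ (a + b) + (c + d)
  interchange = solve-∀

-- Residue classes in windows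

window-≤ : ∀ p c {lo i i′} → lo ≤ p * i′ + c → p * i + c < lo + p → i ≤ i′
window-≤ zero    c {lo} lo≤ <lo = ⊥-elim (ℕP.<-irrefl refl
  (ℕP.<-≤-trans <lo (subst (_≤ c) (sym (ℕP.+-identityʳ lo)) lo≤)))
window-≤ p@(suc _) c {lo} {i} {i′} lo≤ <lo = ℕP.<⇒≤pred (ℕP.*-cancelˡ-< p i (suc i′)
  (ℕP.+-cancelʳ-< c (p * i) (p * suc i′) (begin-strict
    p * i + c      <⟨ <lo ⟩
    lo + p         ≤⟨ ℕP.+-monoˡ-≤ p lo≤ ⟩
    p * i′ + c + p ≡⟨ shift p i′ c ⟩
    p * suc i′ + c ∎)))
  where
  open ℕP.≤-Reasoning
  shift : ∀ p i c → p * i + c + p ≡ p * suc i + c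
  shift = solve-∀

window-unique : ∀ p c {lo i i′} → Interval lo (lo + p) (p * i + c) → Interval lo (lo + p) (p * i′ + c) → i ≡ i′
window-unique p c (lo≤ , <lo) (lo≤′ , <lo′) = ℕP.≤-antisym (window-≤ p c lo≤′ <lo) (window-≤ p c lo≤ <lo′)

window-exists : ∀ p c lo → c < p → Σ ℕ λ i → Interval lo (lo + p) (p * i + c)
window-exists p c zero c<p = 0 , z≤n , subst (_< p) (sym (cong (_+ c) (ℕP.*-zeroʳ p))) c<p
window-exists p c (suc lo) c<p with window-exists p c lo c<p
... | i , lo≤m , m<lo+p with ℕP.m≤n⇒m<n∨m≡n lo≤m
...   | inj₁ lo<m = i , lo<m , ℕP.m<n⇒m<1+n m<lo+p
...   | inj₂ lo≡m = suc i , lo<next , next<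
  where
  next≡ : p * suc i + c ≡ lo + p
  next≡ = trans (shift p i c) (cong (_+ p) (sym lo≡m))
    where shift : ∀ p i c → p * suc i + c ≡ p * i + c + p
          shift = solve-∀
  lo<next : suc lo ≤ p * suc i + c
  lo<next = subst (lo <_) (sym next≡) (ℕP.m<m+n lo (ℕP.<-≤-trans (s≤s z≤n) c<p))
  next< : p * suc i + c < suc lo + p
  next< = subst (_< suc (lo + p)) (sym next≡) (ℕP.n<1+n (lo + p))

-- Put p = l + e + 1 and let
-- [A, A′) and [B, B′) be two windows with A + B = p n and A′ + B′ = p (n+1).
-- Exactly one number of the form p i + l in the first or p j + e in the second
-- window exists.
module Windows (l e n A B A′ B′ : ℕ) (level : A + B ≡ suc (l + e) * n)
  (level′ : A′ + B′ ≡ suc (l + e) * suc n) (A≤A′ : A ≤ A′) (B≤B′ : B ≤ B′) where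

  p : ℕ
  p = suc (l + e)

  InA : ℕ → Set
  InA i = Interval A A′ (p * i + l)

  InB : ℕ → Set
  InB j = Interval B B′ (p * j + e)

  sum-of-residues : ∀ i j → p * i + l + (p * j + e) ≡ p * (i + j) + (l + e)
  sum-of-residues i j = rearrange p i j l e
    where rearrange : ∀ p i j l e → p * i + l + (p * j + e) ≡ p * (i + j) + (l + e)
          rearrange = solve-∀

  p*suc : ∀ m → p * suc m ≡ suc (p * m + (l + e))
  p*suc m = unfold (l + e) m
    where unfold : ∀ q m → suc q * suc m ≡ suc (suc q * m + q)
          unfold = solve-∀

  total-width : A′ + B′ ≡ A + B + p
  total-width = trans level′ (trans (ℕP.*-suc p n) (trans (ℕP.+-comm p (p * n)) (cong (_+ p) (sym level))))

  top : A + B + p ≡ p * suc n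
  top = trans (sym total-width) level′

  A′≤A+p : A′ ≤ A + p
  A′≤A+p = ℕP.+-cancelʳ-≤ B A′ (A + p) (begin
    A′ + B    ≤⟨ ℕP.+-monoʳ-≤ A′ B≤B′ ⟩
    A′ + B′   ≡⟨ total-width ⟩
    A + B + p ≡⟨ swap A B p ⟩
    A + p + B ∎)
    where open ℕP.≤-Reasoning
          swap : ∀ a b c → a + b + c ≡ a + c + b
          swap = solve-∀

  B′≤B+p : B′ ≤ B + p
  B′≤B+p = ℕP.+-cancelʳ-≤ A B′ (B + p) (begin
    B′ + A    ≤⟨ ℕP.+-monoʳ-≤ B′ A≤A′ ⟩
    B′ + A′   ≡⟨ trans (ℕP.+-comm B′ A′) total-width ⟩
    A + B + p ≡⟨ rotate A B p ⟩
    B + p + A ∎)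
    where open ℕP.≤-Reasoning
          rotate : ∀ a b c → a + b + c ≡ b + c + a
          rotate = solve-∀

  A-unique : ∀ {i i′} → InA i → InA i′ → i ≡ i′
  A-unique (A≤ , <A′) (A≤′ , <A′′) =
    window-unique p l (A≤ , ℕP.<-≤-trans <A′ A′≤A+p) (A≤′ , ℕP.<-≤-trans <A′′ A′≤A+p)

  B-unique : ∀ {j j′} → InB j → InB j′ → j ≡ j′
  B-unique (B≤ , <B′) (B≤′ , <B′′) =
    window-unique p e (B≤ , ℕP.<-≤-trans <B′ B′≤B+p) (B≤′ , ℕP.<-≤-trans <B′′ B′≤B+p)

  -- If p i + l and p j + e both occurred, their sum p (i+j) + (p−1) would lie
  -- in [p n, p (n+1) − 2], which contains no number ≡ −1 mod p.
  disjoint : ∀ {i j} → InA i → InB j → ⊥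
  disjoint {i} {j} (A≤ , <A′) (B≤ , <B′) = ℕP.<⇒≱ s<n n≤s
    where
    open ℕP.≤-Reasoning
    s = i + j
    n≤s : n ≤ s
    n≤s = ℕP.<⇒≤pred (ℕP.*-cancelˡ-< p n (suc s) (begin-strict
      p * n                   ≡⟨ sym level ⟩
      A + B                   ≤⟨ ℕP.+-mono-≤ A≤ B≤ ⟩
      p * i + l + (p * j + e) ≡⟨ sum-of-residues i j ⟩
      p * s + (l + e)         <⟨ ℕP.n<1+n _ ⟩
      suc (p * s + (l + e))   ≡⟨ sym (p*suc s) ⟩
      p * suc s               ∎))
    s<n : s < n
    s<n = s<s⁻¹ (ℕP.*-cancelˡ-< p (suc s) (suc n) (begin-strict
      p * suc s                          ≡⟨ trans (p*suc s) (cong suc (sym (sum-of-residues i j))) ⟩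
      suc (p * i + l + (p * j + e))      <⟨ s≤s (ℕP.≤-reflexive (sym (ℕP.+-suc (p * i + l) (p * j + e)))) ⟩
      suc (p * i + l) + suc (p * j + e)  ≤⟨ ℕP.+-mono-≤ <A′ <B′ ⟩
      A′ + B′                            ≡⟨ level′ ⟩
      p * suc n                          ∎))

  -- If the member m = p i + l of [A, A + p) lies beyond the first window, its
  -- reflection k = p n + (p − 1) − m = p (n − i) + e lies in the second one.
  reflect : ∀ i → p * i + l < A + p → A′ ≤ p * i + l → Σ ℕ InB
  reflect i m<A+p A′≤m = n ∸ i , B≤k , k<B′
    where
    open ℕP.≤-Reasoning
    m = p * i + l
    k = p * (n ∸ i) + e
    i≤n : i ≤ n
    i≤n = ℕP.<⇒≤pred (ℕP.*-cancelˡ-< p i (suc n) (begin-strict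
      p * i     ≤⟨ ℕP.m≤m+n (p * i) l ⟩
      m         <⟨ m<A+p ⟩
      A + p     ≤⟨ ℕP.+-monoˡ-≤ p (ℕP.m≤m+n A B) ⟩
      A + B + p ≡⟨ top ⟩
      p * suc n ∎))
    m+k : A + B + p ≡ suc (m + k)
    m+k = trans top (trans (p*suc n)
      (cong suc (sym (trans (sum-of-residues i (n ∸ i))
        (cong (λ z → p * z + (l + e)) (ℕP.m+[n∸m]≡n i≤n))))))
    B≤k : B ≤ k
    B≤k = ℕP.+-cancelʳ-≤ (suc m) B k (begin
      B + suc m     ≤⟨ ℕP.+-monoʳ-≤ B m<A+p ⟩
      B + (A + p)   ≡⟨ regroup A B p ⟩
      A + B + p     ≡⟨ m+k ⟩
      suc (m + k)   ≡⟨ cong suc (ℕP.+-comm m k) ⟩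
      suc (k + m)   ≡⟨ sym (ℕP.+-suc k m) ⟩
      k + suc m     ∎)
      where regroup : ∀ a b c → b + (a + c) ≡ a + b + c
            regroup = solve-∀
    k<B′ : k < B′
    k<B′ = ℕP.+-cancelˡ-≤ m (suc k) B′ (begin
      m + suc k   ≡⟨ ℕP.+-suc m k ⟩
      suc (m + k) ≡⟨ sym (trans total-width m+k) ⟩
      A′ + B′     ≤⟨ ℕP.+-monoˡ-≤ B′ A′≤m ⟩
      m + B′      ∎)

  -- The residue class of l meets [A, A + p); its member lies in the first
  -- window or is reflected into the second.
  exists : Σ ℕ InA ⊎ Σ ℕ InB
  exists with window-exists p l A (ℕP.m≤m+n (suc l) e)
  ... | i , A≤m , m<A+p with p * i + l <? A′
  ...   | yes m<A′ = inj₁ (i , A≤m , m<A′)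
  ...   | no  m≮A′ = inj₂ (reflect i m<A+p (ℕP.≮⇒≥ m≮A′))

module Residues (l e : ℕ) (α β : Irrational) (α>0 : Positive α) (β>0 : Positive β)
  (complementary : PComplementary (suc (l + e)) (λ i n → FloorIs α i n) (λ j n → FloorIs β (suc j) n))
  where

  p : ℕ
  p = suc (l + e)

  module Cα = Counting (FloorStaircase.staircase α α>0)
  module Cβ = Counting (FloorStaircase.shiftedStaircase β β>0)

  A B : ℕ → ℕ
  A = Cα.count
  B = Cβ.count

  fibreα : ∀ n → Σ ℕ (λ i → FloorIs α i n) ↔ Fin (A (suc n) ∸ A n)
  fibreα n = Cα.step↔Fin {n} (FloorIs-isProp α n) (λ k → floor⇒step α k n) (λ k → step⇒floor α k n)

  fibreβ : ∀ n → Σ ℕ (λ j → FloorIs β (suc j) n) ↔ Fin (B (suc n) ∸ B n)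
  fibreβ n = Cβ.step↔Fin {n} (λ k → FloorIs-isProp β n (suc k))
    (λ k → floor⇒step β (suc k) n) (λ k → step⇒floor β (suc k) n)

  growth : ∀ n → (A (suc n) ∸ A n) + (B (suc n) ∸ B n) ≡ p
  growth n = ↔⇒≡ (↔-trans FinP.+↔⊎ (↔-trans (↔-sym (fibreα n ⊎-↔ fibreβ n)) (complementary n)))

  level : ∀ n → A n + B n ≡ p * n
  level = telescope p A B (cong₂ _+_ Cα.count-zero Cβ.count-zero) Cα.count-mono Cβ.count-mono growth

  shifted-index : ∀ j → p * suc j ∸ l ≡ suc (p * j + e)
  shifted-index j = trans (cong (_∸ l) (expand l e j)) (ℕP.m+n∸m≡n l _)
    where expand : ∀ l e j → suc (l + e) * suc j ≡ l + suc (suc (l + e) * j + e)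
          expand = solve-∀

  -- At level n the conditions ⌊α (p i + l)⌋ = n and ⌊β (p (j+1) − l)⌋ = n
  -- mean membership of p i + l resp. p j + e in the windows at level n, so
  -- the window arithmetic yields exactly one solution.
  residues-complementary :
    PComplementary 1 (λ i n → FloorIs α (p * i + l) n) (λ j n → FloorIs β (p * suc j ∸ l) n)
  residues-complementary n = exactlyOne↔Fin1 {P} {Q} isPropP isPropQ
    (λ u v → A-unique (P⇒InA u) (P⇒InA v)) (λ u v → B-unique (Q⇒InB u) (Q⇒InB v))
    (λ u v → disjoint (P⇒InA u) (Q⇒InB v)) witness
    where
    open Windows l e n (A n) (B n) (A (suc n)) (B (suc n)) (level n) (level (suc n))
      (Cα.count-mono n) (Cβ.count-mono n) using (InA; InB; A-unique; B-unique; disjoint; exists)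
    P Q : ℕ → Set
    P i = FloorIs α (p * i + l) n
    Q j = FloorIs β (p * suc j ∸ l) n
    isPropP : IsPropFamily P
    isPropP i = FloorIs-isProp α n (p * i + l)
    isPropQ : IsPropFamily Q
    isPropQ j = FloorIs-isProp β n (p * suc j ∸ l)
    P⇒InA : ∀ {i} → P i → InA i
    P⇒InA {i} u = Cα.step⇒interval {p * i + l} {n} (floor⇒step α (p * i + l) n u)
    Q⇒InB : ∀ {j} → Q j → InB j
    Q⇒InB {j} u = Cβ.step⇒interval {p * j + e} {n}
      (floor⇒step β (suc (p * j + e)) n (subst (λ k → FloorIs β k n) (shifted-index j) u))
    InA⇒P : ∀ {i} → InA i → P i
    InA⇒P {i} x = step⇒floor α (p * i + l) n (Cα.interval⇒step {p * i + l} {n} x)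
    InB⇒Q : ∀ {j} → InB j → Q j
    InB⇒Q {j} y = subst (λ k → FloorIs β k n) (sym (shifted-index j))
      (step⇒floor β (suc (p * j + e)) n (Cβ.interval⇒step {p * j + e} {n} y))
    witness : Σ ℕ P ⊎ Σ ℕ Q
    witness = map (λ (i , x) → i , InA⇒P x) (λ (j , y) → j , InB⇒Q y) exists

proposition3p2 : (p : ℕ) → p ≥ 2 → (α β : Irrational) →
    Positive α → α <ᵢ β →
    PComplementary p (λ i n → FloorIs α i n) (λ j n → FloorIs β (suc j) n) →
    (l : ℕ) → l < p →
    PComplementary 1 (λ i n → FloorIs α (p * i + l) n) (λ j n → FloorIs β (p * suc j ∸ l) n)
proposition3p2 p _ α β α>0 α<β complementary l l<p =
  atDecomposition p (ℕP.m+[n∸m]≡n l<p) complementary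
  where
  e : ℕ
  e = p ∸ suc l
  atDecomposition : ∀ p → suc (l + e) ≡ p →
    PComplementary p (λ i n → FloorIs α i n) (λ j n → FloorIs β (suc j) n) →
    PComplementary 1 (λ i n → FloorIs α (p * i + l) n) (λ j n → FloorIs β (p * suc j ∸ l) n)
  atDecomposition _ refl hyp = Residues.residues-complementary l e α β α>0 (positive-mono {α} {β} α>0 α<β) hyp
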